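{- A tree $T$ with at least $3$ vertices is $3$-lid-colorable if and only if the distance between every two leaves of $T$ is even.
   Context: For a vertex $u$, $N[u]$ is its closed neighborhood; for a coloring $c$ and vertex set $S$, $c(S)$ is the set of colors on $S$. A lid-coloring is a proper vertex-coloring $c$ such that for every edge $uv$ with $N[u]\neq N[v]$, $c(N[u])\neq c(N[v])$. A graph is $k$-lid-colorable if it has a lid-coloring with at most $k$ colors. -}

module Defs where

open import Data.Nat using (ℕ; zero; suc; _+_; _≤_; _<_)
open import Data.Fin using (Fin; zero; suc; inject₁; fromℕ)
open import Data.Bool using (Bool; T)
open import Data.Product using (Σ; ∃; ∃-syntax; _×_; _,_)
open import Data.Sum using (_⊎_)
open import Relation.Nullary using (¬_)
open import Relation.Binary.PropositionalEquality using (_≡_)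
open import Function.Definitions using (Injective)
open import Function.Bundles using (_⇔_)

record Graph (n : ℕ) : Set where
  field
    adj   : Fin n → Fin n → Bool
    sym   : ∀ u v → adj u v ≡ adj v u
    irrefl : ∀ u → ¬ T (adj u u)

module _ {n : ℕ} (G : Graph n) where
  open Graph G

  Adj : Fin n → Fin n → Set
  Adj u v = T (adj u v)

  data Walk : Fin n → Fin n → ℕ → Set where
    nil  : ∀ {u} → Walk u u 0
    cons : ∀ {u w v l} → Adj u w → Walk w v l → Walk u v (suc l)

  Connected : Set
  Connected = ∀ u v → ∃[ l ] Walk u v l

  HasCycle : Set
  HasCycle = ∃[ k ] Σ (Fin (3 + k) → Fin n) λ f →
      Injective _≡_ _≡_ f
    × (∀ (i : Fin (2 + k)) → Adj (f (inject₁ i)) (f (suc i)))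
    × Adj (f (fromℕ (2 + k))) (f zero)

  IsTree : Set
  IsTree = Connected × ¬ HasCycle

  Distance : Fin n → Fin n → ℕ → Set
  Distance u v d = Walk u v d × (∀ l → Walk u v l → d ≤ l)

  IsLeaf : Fin n → Set
  IsLeaf v = ∃[ w ] (Adj v w × (∀ x → Adj v x → x ≡ w))

  N[_] : Fin n → Fin n → Set
  N[ u ] x = (x ≡ u) ⊎ Adj u x

  colours : ∀ {k} → (Fin n → Fin k) → Fin n → Fin k → Set
  colours c u a = ∃[ x ] (N[ u ] x × c x ≡ a)

  ProperColouring : ∀ {k} → (Fin n → Fin k) → Set
  ProperColouring c = ∀ u v → Adj u v → ¬ (c u ≡ c v)

  -- lid-colouring: proper, and for every edge uv with N[u] ≠ N[v]
  -- we have c(N[u]) ≠ c(N[v])  (set equality = extensional equality)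
  IsLidColouring : ∀ {k} → (Fin n → Fin k) → Set
  IsLidColouring c = ProperColouring c ×
    (∀ u v → Adj u v →
       ¬ (∀ x → N[ u ] x ⇔ N[ v ] x) →
       ¬ (∀ a → colours c u a ⇔ colours c v a))

  -- at most k colours: a colouring with values in Fin k
  LidColourable : ℕ → Set
  LidColourable k = ∃[ c ] IsLidColouring {k} c

  AllLeafDistancesEven : Set
  AllLeafDistancesEven = ∀ u v d → IsLeaf u → IsLeaf v → Distance u v d →
    ∃[ m ] d ≡ m + m

module Submission where

-- (⇒) Call u full when N[u] sees all three colours.  In such a tree
-- adjacent u, v have N[u] ≠ N[v], so a lid-colouring gives them different
-- colour sets; as both contain c(u) ≠ c(v), exactly one of u, v is full.
-- Fullness thus alternates along walks, and leaves are never full.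
-- (⇐) Root the tree at a leaf and colour depth k by the pattern
-- 1,0,2,0,1,0,2,0,…  Leaves lie at even depth, so odd vertices have
-- children, and on an edge between depths k, k+1 the colour of depth
-- k-1 or k+2 separates the two colour sets.
--
-- The tree structure used (neighbours' depths differ by one, parents
-- are unique, leaves exist) is derived in GraphFacts: two vertices of
-- equal depth are joined through their lowest common ancestor by a
-- simple path, which an edge or a common deeper neighbour would close
-- into a cycle.

open import Defs
open import Data.Nat using (ℕ; zero; suc; _+_; _≤_; _<_; z≤n; s≤s; parity)
open import Data.Nat.Properties
  using (≤-refl; ≤-trans; ≤-antisym; ≤-pred; <⇒≤; ≮⇒≥; <-≤-trans; <-irrefl; <-cmp;
         m≤n⇒m≤1+n; m≤m+n; +-mono-≤; +-suc; +-identityʳ; +-cancelˡ-≡; +-cancelʳ-≡;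
         suc-injective; n≢0⇒n>0; n≤0⇒n≡0)
open import Data.Parity using (Parity; 0ℙ; 1ℙ; _⁻¹) renaming (_+_ to _⊕_)
open import Data.Parity.Properties using (p≢p⁻¹; p+p≡0ℙ; suc-homo-⁻¹; +-homo-+)
open import Data.Fin using (Fin; zero; suc; toℕ; inject₁; fromℕ; _≟_)
open import Data.Fin.Properties
  using (any?; all?; toℕ-injective; toℕ<n; toℕ-inject₁; toℕ-fromℕ; ¬∀⟶∃¬)
open import Data.List using (allFin)
open import Data.List.Extrema.Nat using (argmax; f[xs]≤f[argmax])
open import Data.List.Membership.Propositional.Properties using (∈-allFin)
import Data.List.Relation.Unary.All as All
open import Data.Bool using (T)
open import Data.Unit using (tt)
open import Data.Product using (Σ; ∃; ∃-syntax; _×_; _,_; proj₁; proj₂)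
open import Data.Sum using (_⊎_; inj₁; inj₂; [_,_])
open import Data.Empty using (⊥; ⊥-elim)
open import Relation.Nullary using (¬_; Dec; yes; no)
open import Relation.Nullary.Decidable using (T?; _×-dec_; _⊎-dec_; _→-dec_; ¬?; map′; toWitness)
open import Relation.Binary.PropositionalEquality
  using (_≡_; _≢_; refl; sym; trans; cong; cong₂; subst; subst₂; module ≡-Reasoning)
open import Relation.Binary.Definitions using (tri<; tri≈; tri>)
open import Function using (_∘_)
open import Function.Definitions using (Injective)
open import Function.Bundles using (_⇔_; mk⇔; Equivalence)
import Function.Properties.Equivalence as ⇔

open ≡-Reasoning

least : ∀ {P : ℕ → Set} → (∀ i → Dec (P i)) → ∀ {L} → P L →
        Σ ℕ λ j → P j × (∀ i → i < j → ¬ P i)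
least P? {L} pL with P? 0
... | yes p0 = 0 , p0 , λ _ ()
least P? {zero}  pL | no ¬p0 = ⊥-elim (¬p0 pL)
least P? {suc L} pL | no ¬p0 with least (λ i → P? (suc i)) {L} pL
... | j , pj , below = suc j , pj , λ { zero _ → ¬p0 ; (suc i) (s≤s i<j) → below i i<j }

differ-by-one : ∀ {x y} → x ≤ suc y → y ≤ suc x → x ≢ y → y ≡ suc x ⊎ x ≡ suc y
differ-by-one {x} {y} x≤ y≤ x≢y with <-cmp x y
... | tri< x<y _ _ = inj₁ (≤-antisym y≤ x<y)
... | tri≈ _ x≡y _ = ⊥-elim (x≢y x≡y)
... | tri> _ _ y<x = inj₂ (≤-antisym x≤ y<x)

even⇒double : ∀ l → parity l ≡ 0ℙ → ∃[ m ] l ≡ m + m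
even⇒double zero _ = 0 , refl
even⇒double (suc zero) ()
even⇒double (suc (suc l)) ev with even⇒double l ev
... | m , l≡m+m = suc m , cong suc (trans (cong suc l≡m+m) (sym (+-suc m m)))

double⇒even : ∀ m → parity (m + m) ≡ 0ℙ
double⇒even m = trans (+-homo-+ m m) (p+p≡0ℙ (parity m))

odd-positive : ∀ k → parity k ≡ 1ℙ → 0 < k
odd-positive (suc k) _ = s≤s z≤n

parity-suc : ∀ k → parity (suc k) ≡ parity k ⁻¹
parity-suc k = +-homo-+ 1 k

⊕-through : ∀ p q s → p ⊕ s ≡ (p ⊕ q) ⊕ (q ⊕ s)
⊕-through 0ℙ 0ℙ 0ℙ = refl
⊕-through 0ℙ 0ℙ 1ℙ = refl
⊕-through 0ℙ 1ℙ 0ℙ = refl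
⊕-through 0ℙ 1ℙ 1ℙ = refl
⊕-through 1ℙ 0ℙ 0ℙ = refl
⊕-through 1ℙ 0ℙ 1ℙ = refl
⊕-through 1ℙ 1ℙ 0ℙ = refl
⊕-through 1ℙ 1ℙ 1ℙ = refl

indicator : ∀ {A : Set} → Dec A → Parity
indicator (yes _) = 1ℙ
indicator (no _)  = 0ℙ

indicator-no : ∀ {A : Set} (a? : Dec A) → ¬ A → indicator a? ≡ 0ℙ
indicator-no (yes a) ¬a = ⊥-elim (¬a a)
indicator-no (no _)  _  = refl

indicator-exclusive : ∀ {A B : Set} (a? : Dec A) (b? : Dec B) →
  (A → B → ⊥) → (¬ A → ¬ B → ⊥) → indicator a? ⊕ indicator b? ≡ 1ℙ
indicator-exclusive (yes a) (yes b) both neither = ⊥-elim (both a b)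
indicator-exclusive (yes _) (no _)  _    _       = refl
indicator-exclusive (no _)  (yes _) _    _       = refl
indicator-exclusive (no ¬a) (no ¬b) both neither = ⊥-elim (neither ¬a ¬b)

third-colour : ∀ (p q : Fin 3) → ∃[ t ] t ≢ p × t ≢ q
third-colour = toWitness {a? = all? λ p → all? λ q → any? λ t → ¬? (t ≟ p) ×-dec ¬? (t ≟ q)} tt

third-unique : ∀ {p q x y : Fin 3} → p ≢ q → x ≢ p → x ≢ q → y ≢ p → y ≢ q → x ≡ y
third-unique {p} {q} {x} {y} = toWitness {a? = decision} tt p q x y
  where
  decision : Dec (∀ (p q x y : Fin 3) → p ≢ q → x ≢ p → x ≢ q → y ≢ p → y ≢ q → x ≡ y)
  decision = all? λ p → all? λ q → all? λ x → all? λ y →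
    ¬? (p ≟ q) →-dec ¬? (x ≟ p) →-dec ¬? (x ≟ q) →-dec
    ¬? (y ≟ p) →-dec ¬? (y ≟ q) →-dec (x ≟ y)

-- Two sets of colours that both contain two distinct colours p, q and
-- both miss some colour are equal: each consists of exactly p and q.
same-colour-sets : ∀ {P Q : Fin 3 → Set} {p q} → p ≢ q → P p → P q → Q p → Q q →
  ∃ (λ a → ¬ P a) → ∃ (λ b → ¬ Q b) → ∀ x → P x ⇔ Q x
same-colour-sets {P} {Q} {p} {q} p≢q Pp Pq Qp Qq (_ , ¬Pa) (_ , ¬Qb) x with x ≟ p | x ≟ q
... | yes refl | _        = mk⇔ (λ _ → Qp) (λ _ → Pp)
... | no _     | yes refl = mk⇔ (λ _ → Qq) (λ _ → Pq)
... | no x≢p   | no x≢q   =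
  mk⇔ (⊥-elim ∘ ¬Pa ∘ subst P (is-missing Pp Pq ¬Pa))
      (⊥-elim ∘ ¬Qb ∘ subst Q (is-missing Qp Qq ¬Qb))
  where
  -- x is the only colour besides p and q, so it is the colour a set misses
  is-missing : ∀ {R : Fin 3 → Set} {d} → R p → R q → ¬ R d → x ≡ d
  is-missing Rp Rq ¬Rd = third-unique p≢q x≢p x≢q (λ { refl → ¬Rd Rp }) (λ { refl → ¬Rd Rq })

levelColour : ℕ → Fin 3
levelColour 0 = suc zero
levelColour 1 = zero
levelColour 2 = suc (suc zero)
levelColour 3 = zero
levelColour (suc (suc (suc (suc k)))) = levelColour k

levelColour-step : ∀ k → levelColour k ≢ levelColour (suc k)
levelColour-step 0 ()
levelColour-step 1 ()
levelColour-step 2 ()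
levelColour-step 3 ()
levelColour-step (suc (suc (suc (suc k)))) = levelColour-step k

levelColour-odd : ∀ k → parity k ≡ 1ℙ → levelColour k ≡ zero
levelColour-odd 0 ()
levelColour-odd 1 _ = refl
levelColour-odd 2 ()
levelColour-odd 3 _ = refl
levelColour-odd (suc (suc (suc (suc k)))) = levelColour-odd k

levelColour-even : ∀ k → parity k ≡ 0ℙ → levelColour k ≢ zero
levelColour-even 0 _ ()
levelColour-even 1 ()
levelColour-even 2 _ ()
levelColour-even 3 ()
levelColour-even (suc (suc (suc (suc k)))) = levelColour-even k

levelColour-skip : ∀ j → parity j ≡ 0ℙ → levelColour j ≢ levelColour (2 + j)
levelColour-skip 0 _ ()
levelColour-skip 1 ()
levelColour-skip 2 _ ()
levelColour-skip 3 ()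
levelColour-skip (suc (suc (suc (suc j)))) = levelColour-skip j

levelColour-two-apart : ∀ {j k} → parity j ≡ 0ℙ → k ≡ 2 + j ⊎ j ≡ 2 + k →
  levelColour k ≢ levelColour j
levelColour-two-apart {j} ev (inj₁ refl) = levelColour-skip j ev ∘ sym
levelColour-two-apart {k = k} ev (inj₂ refl) = levelColour-skip k ev

module GraphFacts {n : ℕ} (G : Graph n) where

  adj-sym : ∀ {u v} → Adj G u v → Adj G v u
  adj-sym {u} {v} = subst T (Graph.sym G u v)

  adj⇒≢ : ∀ {u v} → Adj G u v → u ≢ v
  adj⇒≢ {u} loop refl = Graph.irrefl G u loop

  walk? : ∀ l u v → Dec (Walk G u v l)
  walk? zero u v = map′ (λ { refl → nil }) (λ { nil → refl }) (u ≟ v)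
  walk? (suc l) u v = map′ (λ (w , uw , p) → cons uw p) (λ { (cons uw p) → _ , uw , p })
    (any? λ w → T? (Graph.adj G u w) ×-dec walk? l w v)

  record PathIn (S : Fin n → Set) (a b : Fin n) (len : ℕ) : Set where
    field
      vertex   : ℕ → Fin n
      start    : vertex 0 ≡ a
      end      : vertex len ≡ b
      inside   : ∀ i → i ≤ len → S (vertex i)
      distinct : ∀ i j → i ≤ len → j ≤ len → vertex i ≡ vertex j → i ≡ j
      linked   : ∀ i → i < len → Adj G (vertex i) (vertex (suc i))

  single : ∀ a → PathIn (_≡ a) a a 0
  single a = record
    { vertex = λ _ → a ; start = refl ; end = refl ; inside = λ _ _ → refl
    ; distinct = λ { _ _ z≤n z≤n _ → refl } ; linked = λ _ () }

  weaken : ∀ {S S′ a b len} → (∀ {x} → S x → S′ x) → PathIn S a b len → PathIn S′ a b len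
  weaken S⊆S′ P = record
    { vertex = vertex ; start = start ; end = end ; inside = λ i i≤ → S⊆S′ (inside i i≤)
    ; distinct = distinct ; linked = linked }
    where open PathIn P

  prepend : ∀ {S a b len v} → Adj G v a → ¬ S v → PathIn S a b len →
            PathIn (λ x → x ≡ v ⊎ S x) v b (suc len)
  prepend {S} {len = len} {v = v} va v∉S P = record
    { vertex = vertex′ ; start = refl ; end = end
    ; inside = inside′ ; distinct = distinct′ ; linked = linked′ }
    where
    open PathIn P
    vertex′ : ℕ → Fin n
    vertex′ zero    = v
    vertex′ (suc i) = vertex i
    inside′ : ∀ i → i ≤ suc len → vertex′ i ≡ v ⊎ S (vertex′ i)
    inside′ zero    _         = inj₁ refl
    inside′ (suc i) (s≤s i≤) = inj₂ (inside i i≤)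
    distinct′ : ∀ i j → i ≤ suc len → j ≤ suc len → vertex′ i ≡ vertex′ j → i ≡ j
    distinct′ zero    zero    _        _        _ = refl
    distinct′ zero    (suc j) _        (s≤s j≤) e = ⊥-elim (v∉S (subst S (sym e) (inside j j≤)))
    distinct′ (suc i) zero    (s≤s i≤) _        e = ⊥-elim (v∉S (subst S e (inside i i≤)))
    distinct′ (suc i) (suc j) (s≤s i≤) (s≤s j≤) e = cong suc (distinct i j i≤ j≤ e)
    linked′ : ∀ i → i < suc len → Adj G (vertex′ i) (vertex′ (suc i))
    linked′ zero    _         = subst (Adj G v) (sym start) va
    linked′ (suc i) (s≤s i<) = linked i i<

  closeCycle : ∀ {S a b len} → PathIn S a b len → 2 ≤ len → Adj G b a → HasCycle G
  closeCycle {len = suc (suc k)} P (s≤s (s≤s z≤n)) ba = k , f , f-injective , f-linked , f-closed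
    where
    open PathIn P
    f : Fin (3 + k) → Fin n
    f i = vertex (toℕ i)
    f-injective : Injective _≡_ _≡_ f
    f-injective {i} {j} e =
      toℕ-injective (distinct (toℕ i) (toℕ j) (≤-pred (toℕ<n i)) (≤-pred (toℕ<n j)) e)
    f-linked : ∀ (i : Fin (2 + k)) → Adj G (f (inject₁ i)) (f (suc i))
    f-linked i rewrite toℕ-inject₁ i = linked (toℕ i) (toℕ<n i)
    f-closed : Adj G (f (fromℕ (2 + k))) (f zero)
    f-closed rewrite toℕ-fromℕ (2 + k) = subst₂ (Adj G) (sym end) (sym start) ba

  triangle : ∀ {u v w} → Adj G u v → Adj G v w → Adj G w u → HasCycle G
  triangle {u} {v} {w} uv vw wu =
    closeCycle (prepend uv u∉ (prepend vw (adj⇒≢ vw) (single _))) (s≤s (s≤s z≤n)) wu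
    where
    u∉ : ¬ (u ≡ v ⊎ u ≡ w)
    u∉ = [ adj⇒≢ uv , adj⇒≢ wu ∘ sym ]

  module Rooted (connected : Connected G) (r : Fin n) where

    -- opaque, so that the search for a shortest walk is never unfolded
    opaque
      distanceToRoot : ∀ u → Σ ℕ (Distance G u r)
      distanceToRoot u with least (λ l → walk? l u r) (proj₂ (connected u r))
      ... | d , w , shorter = d , w , λ l w′ → ≮⇒≥ (λ l<d → shorter l l<d w′)

    depth : Fin n → ℕ
    depth u = proj₁ (distanceToRoot u)

    depth-distance : ∀ u → Distance G u r (depth u)
    depth-distance u = proj₂ (distanceToRoot u)

    depth-min : ∀ {u l} → Walk G u r l → depth u ≤ l
    depth-min {u} {l} = proj₂ (depth-distance u) l

    depth-adj : ∀ {u v} → Adj G u v → depth u ≤ suc (depth v)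
    depth-adj {v = v} uv = depth-min (cons uv (proj₁ (depth-distance v)))

    depth≡0 : ∀ {u} → depth u ≡ 0 → u ≡ r
    depth≡0 {u} d≡0 with subst (Walk G u r) d≡0 (proj₁ (depth-distance u))
    ... | nil = refl

    towardsRoot : ∀ u → u ≡ r ⊎ Σ (Fin n) λ w → Adj G u w × suc (depth w) ≡ depth u
    towardsRoot u with depth u in d≡
    ... | zero = inj₁ (depth≡0 d≡)
    ... | suc k with subst (Walk G u r) d≡ (proj₁ (depth-distance u))
    ...   | cons {w = w} uw p =
            inj₂ (w , uw , ≤-antisym (s≤s (depth-min p)) (subst (_≤ suc (depth w)) d≡ (depth-adj uw)))

    -- the parent of a non-root vertex (the root is its own parent)
    parent : Fin n → Fin n
    parent u with towardsRoot u
    ... | inj₁ _ = u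
    ... | inj₂ (w , _) = w

    parent-spec : ∀ u → 0 < depth u → Adj G u (parent u) × suc (depth (parent u)) ≡ depth u
    parent-spec u pos with towardsRoot u
    ... | inj₁ refl = ⊥-elim (<-irrefl (sym (n≤0⇒n≡0 (depth-min nil))) pos)
    ... | inj₂ (w , uw , d) = uw , d

    ancestor : Fin n → ℕ → Fin n
    ancestor a zero    = a
    ancestor a (suc i) = parent (ancestor a i)

    ancestor-depth : ∀ a i → i ≤ depth a → depth (ancestor a i) + i ≡ depth a
    ancestor-positive : ∀ a i → i < depth a → 0 < depth (ancestor a i)

    ancestor-depth a zero _ = +-identityʳ (depth a)
    ancestor-depth a (suc i) i<d = begin
      depth (parent x) + suc i   ≡⟨ +-suc (depth (parent x)) i ⟩
      suc (depth (parent x)) + i ≡⟨ cong (_+ i) (proj₂ (parent-spec x (ancestor-positive a i i<d))) ⟩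
      depth x + i                ≡⟨ ancestor-depth a i (<⇒≤ i<d) ⟩
      depth a                    ∎
      where x = ancestor a i

    ancestor-positive a i i<d with depth (ancestor a i) | ancestor-depth a i (<⇒≤ i<d)
    ... | zero  | i≡d = ⊥-elim (<-irrefl i≡d i<d)
    ... | suc _ | _   = s≤s z≤n

    ancestor-adj : ∀ a i → i < depth a → Adj G (ancestor a i) (ancestor a (suc i))
    ancestor-adj a i i<d = proj₁ (parent-spec (ancestor a i) (ancestor-positive a i i<d))

    ancestor-below : ∀ a i → i ≤ depth a → depth (ancestor a i) ≤ depth a
    ancestor-below a i i≤d = subst (depth (ancestor a i) ≤_) (ancestor-depth a i i≤d) (m≤m+n _ i)

    ancestor-root : ∀ a → ancestor a (depth a) ≡ r
    ancestor-root a = depth≡0 (+-cancelʳ-≡ (depth a) _ 0 (ancestor-depth a (depth a) ≤-refl))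

    ancestor-level : ∀ {a b i j} → depth a ≡ depth b → i ≤ depth a → j ≤ depth b →
                     ancestor a i ≡ ancestor b j → i ≡ j
    ancestor-level {a} {b} {i} {j} same i≤ j≤ e = +-cancelˡ-≡ (depth (ancestor a i)) i j (begin
      depth (ancestor a i) + i ≡⟨ ancestor-depth a i i≤ ⟩
      depth a                  ≡⟨ same ⟩
      depth b                  ≡⟨ sym (ancestor-depth b j j≤) ⟩
      depth (ancestor b j) + j ≡⟨ cong (λ y → depth y + j) (sym e) ⟩
      depth (ancestor a i) + j ∎)

    AncestorOf : Fin n → ℕ → Fin n → Set
    AncestorOf b k x = ∃[ j ] j ≤ k × x ≡ ancestor b j

    descent : ∀ b k → k ≤ depth b → PathIn (AncestorOf b k) (ancestor b k) b k
    descent b zero _ = weaken (λ x≡b → 0 , z≤n , x≡b) (single b)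
    descent b (suc k) k<d =
      weaken extend (prepend (adj-sym (ancestor-adj b k k<d)) fresh (descent b k (<⇒≤ k<d)))
      where
      fresh : ¬ AncestorOf b k (ancestor b (suc k))
      fresh (j , j≤k , e) =
        <-irrefl refl (subst (_≤ k) (sym (ancestor-level refl k<d (≤-trans j≤k (<⇒≤ k<d)) e)) j≤k)
      extend : ∀ {x} → x ≡ ancestor b (suc k) ⊎ AncestorOf b k x → AncestorOf b (suc k) x
      extend (inj₁ e) = suc k , ≤-refl , e
      extend (inj₂ (j , j≤k , e)) = j , m≤n⇒m≤1+n j≤k , e

    module Fork {a b} (a≢b : a ≢ b) (same : depth a ≡ depth b) where

      -- both ancestor chains end at the root
      meet-at-root : ancestor a (depth a) ≡ ancestor b (depth a)
      meet-at-root =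
        trans (ancestor-root a) (sym (subst (λ d → ancestor b d ≡ r) (sym same) (ancestor-root b)))

      lca : Σ ℕ λ m → ancestor a m ≡ ancestor b m × (∀ i → i < m → ancestor a i ≢ ancestor b i)
      lca = least (λ i → ancestor a i ≟ ancestor b i) {depth a} meet-at-root

      m : ℕ
      m = proj₁ lca

      lca-meet : ancestor a m ≡ ancestor b m
      lca-meet = proj₁ (proj₂ lca)

      below-lca : ∀ i → i < m → ancestor a i ≢ ancestor b i
      below-lca = proj₂ (proj₂ lca)

      m≤a : m ≤ depth a
      m≤a = ≮⇒≥ λ d<m → below-lca (depth a) d<m meet-at-root

      m≤b : m ≤ depth b
      m≤b = subst (m ≤_) same m≤a

      m-positive : 0 < m
      m-positive = n≢0⇒n>0 λ m≡0 → a≢b (subst (λ i → ancestor a i ≡ ancestor b i) m≡0 lca-meet)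

      Arm : ℕ → Fin n → Set
      Arm k x = (∃[ j ] k ≤ j × j ≤ m × x ≡ ancestor a j) ⊎ AncestorOf b m x

      ascent : ∀ t k → k + t ≡ m → PathIn (Arm k) (ancestor a k) b (t + m)
      ascent zero k k≡m = weaken inj₂ (subst (λ s → PathIn (AncestorOf b m) s b m) top (descent b m m≤b))
        where
        top : ancestor b m ≡ ancestor a k
        top = trans (sym lca-meet) (cong (ancestor a) (sym (trans (sym (+-identityʳ k)) k≡m)))
      ascent (suc t) k k+t≡m =
        weaken extend (prepend (ancestor-adj a k k<a) fresh (ascent t (suc k) sk+t≡m))
        where
        sk+t≡m : suc k + t ≡ m
        sk+t≡m = trans (sym (+-suc k t)) k+t≡m
        k<m : k < m
        k<m = subst (suc k ≤_) sk+t≡m (m≤m+n (suc k) t)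
        k<a : k < depth a
        k<a = <-≤-trans k<m m≤a
        fresh : ¬ Arm (suc k) (ancestor a k)
        fresh (inj₁ (j , k<j , j≤m , e)) =
          <-irrefl (ancestor-level refl (<⇒≤ k<a) (≤-trans j≤m m≤a) e) k<j
        fresh (inj₂ (j , j≤m , e)) = below-lca k k<m (subst (λ i → ancestor a k ≡ ancestor b i) (sym k≡j) e)
          where
          k≡j : k ≡ j
          k≡j = ancestor-level same (<⇒≤ k<a) (≤-trans j≤m m≤b) e
        extend : ∀ {x} → x ≡ ancestor a k ⊎ Arm (suc k) x → Arm k x
        extend (inj₁ e) = inj₁ (k , ≤-refl , <⇒≤ k<m , e)
        extend (inj₂ (inj₁ (j , k<j , rest))) = inj₁ (j , <⇒≤ k<j , rest)
        extend (inj₂ (inj₂ below-b)) = inj₂ below-b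

      arm-depth : ∀ {k x} → Arm k x → depth x ≤ depth a
      arm-depth (inj₁ (j , _ , j≤m , refl)) = ancestor-below a j (≤-trans j≤m m≤a)
      arm-depth (inj₂ (j , j≤m , refl)) =
        subst (depth (ancestor b j) ≤_) (sym same) (ancestor-below b j (≤-trans j≤m m≤b))

    fork : ∀ {a b} → a ≢ b → depth a ≡ depth b →
           Σ ℕ λ len → 2 ≤ len × PathIn (λ x → depth x ≤ depth a) a b len
    fork a≢b same = m + m , +-mono-≤ m-positive m-positive , weaken arm-depth (ascent m 0 refl)
      where open Fork a≢b same

    module Acyclic (acyclic : ¬ HasCycle G) where

      level-independent : ∀ {a b} → Adj G a b → depth a ≢ depth b
      level-independent ab same with fork (adj⇒≢ ab) same
      ... | len , long , path = acyclic (closeCycle path long (adj-sym ab))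

      depth-step : ∀ {u v} → Adj G u v → depth v ≡ suc (depth u) ⊎ depth u ≡ suc (depth v)
      depth-step uv = differ-by-one (depth-adj uv) (depth-adj (adj-sym uv)) (level-independent uv)

      parent-unique : ∀ {v p q} → Adj G v p → Adj G v q →
                      suc (depth p) ≡ depth v → suc (depth q) ≡ depth v → p ≡ q
      parent-unique {v} {p} {q} vp vq dp dq with p ≟ q
      ... | yes p≡q = p≡q
      ... | no p≢q with fork p≢q (suc-injective (trans dp (sym dq)))
      ...   | len , long , path =
              ⊥-elim (acyclic (closeCycle (prepend vp v-above path) (m≤n⇒m≤1+n long) (adj-sym vq)))
        where
        v-above : ¬ depth v ≤ depth p
        v-above le = <-irrefl refl (subst (_≤ depth p) (sym dp) le)

  -- A tree with two distinct vertices v₀, v₁ has a leaf: a vertex farthest from v₀.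
  leaf-exists : IsTree G → ∀ {v₀ v₁ : Fin n} → v₀ ≢ v₁ → Σ (Fin n) (IsLeaf G)
  leaf-exists (connected , acyclic) {v₀} {v₁} v₀≢v₁ = w , parent w , proj₁ w-spec , only-parent
    where
    open Rooted connected v₀
    open Acyclic acyclic
    w : Fin n
    w = argmax depth v₀ (allFin n)
    farthest : ∀ x → depth x ≤ depth w
    farthest x = All.lookup (f[xs]≤f[argmax] v₀ (allFin n)) (∈-allFin x)
    w-spec : Adj G w (parent w) × suc (depth (parent w)) ≡ depth w
    w-spec = parent-spec w (<-≤-trans (n≢0⇒n>0 (v₀≢v₁ ∘ sym ∘ depth≡0)) (farthest v₁))
    only-parent : ∀ x → Adj G w x → x ≡ parent w
    only-parent x wx with depth-step wx
    ... | inj₁ deeper = ⊥-elim (<-irrefl refl (subst (_≤ depth w) deeper (farthest x)))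
    ... | inj₂ higher = parent-unique wx (proj₁ w-spec) (sym higher) (proj₂ w-spec)

  -- In a tree with a vertex z ∉ {u, v}, adjacent u and v have different
  -- closed neighbourhoods: otherwise {u, v} would be a whole component.
  closedNbhds-differ : IsTree G → ∀ {u v z} → z ≢ u → z ≢ v → Adj G u v →
                       ¬ (∀ x → N[_] G u x ⇔ N[_] G v x)
  closedNbhds-differ (connected , acyclic) {u} {v} {z} z≢u z≢v uv same =
    [ z≢u , z≢v ] (trapped (proj₂ (connected u z)) (inj₁ refl))
    where
    only-neighbour : ∀ {a b x} → Adj G a b → (∀ y → N[_] G a y → N[_] G b y) → Adj G a x → x ≡ b
    only-neighbour {a} {b} {x} ab a⊆b ax with x ≟ b
    ... | yes x≡b = x≡b
    ... | no x≢b with a⊆b x (inj₂ ax)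
    ...   | inj₁ x≡b = ⊥-elim (x≢b x≡b)
    ...   | inj₂ bx  = ⊥-elim (acyclic (triangle ab bx (adj-sym ax)))
    trapped : ∀ {y t l} → Walk G y t l → y ≡ u ⊎ y ≡ v → t ≡ u ⊎ t ≡ v
    trapped nil at = at
    trapped (cons uy p) (inj₁ refl) =
      trapped p (inj₂ (only-neighbour uv (Equivalence.to ∘ same) uy))
    trapped (cons vy p) (inj₂ refl) =
      trapped p (inj₁ (only-neighbour (adj-sym uv) (Equivalence.from ∘ same) vy))

  module Fullness (c : Fin n → Fin 3) where

    colours? : ∀ u a → Dec (colours G c u a)
    colours? u a = any? λ x → ((x ≟ u) ⊎-dec T? (Graph.adj G u x)) ×-dec (c x ≟ a)

    Full : Fin n → Set
    Full u = ∀ a → colours G c u a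

    fullness : Fin n → Parity
    fullness u = indicator (all? (colours? u))

    fullness-edge : IsLidColouring G c → ∀ {u v} → Adj G u v →
                    ¬ (∀ x → N[_] G u x ⇔ N[_] G v x) → fullness u ⊕ fullness v ≡ 1ℙ
    fullness-edge (proper , lid) {u} {v} uv N≢ =
      indicator-exclusive (all? (colours? u)) (all? (colours? v)) both-full neither-full
      where
      both-full : Full u → Full v → ⊥
      both-full fu fv = lid u v uv N≢ λ a → mk⇔ (λ _ → fv a) (λ _ → fu a)
      neither-full : ¬ Full u → ¬ Full v → ⊥
      neither-full ¬fu ¬fv = lid u v uv N≢ (same-colour-sets (proper u v uv)
        (u , inj₁ refl , refl) (v , inj₂ uv , refl)
        (u , inj₂ (adj-sym uv) , refl) (v , inj₁ refl , refl)
        (¬∀⟶∃¬ 3 _ (colours? u) ¬fu) (¬∀⟶∃¬ 3 _ (colours? v) ¬fv))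

    -- the closed neighbourhood of a leaf has only two vertices
    fullness-leaf : ∀ {u} → IsLeaf G u → fullness u ≡ 0ℙ
    fullness-leaf {u} (w , uw , only-w) = indicator-no (all? (colours? u)) not-full
      where
      not-full : ¬ Full u
      not-full fu with third-colour (c u) (c w)
      ... | t , t≢cu , t≢cw with fu t
      ...   | x , inj₁ refl , cx≡t = t≢cu (sym cx≡t)
      ...   | x , inj₂ ux , cx≡t = t≢cw (trans (sym cx≡t) (cong c (only-w x ux)))

    fullness-walk : (∀ {u v} → Adj G u v → fullness u ⊕ fullness v ≡ 1ℙ) →
                    ∀ {u v l} → Walk G u v l → fullness u ⊕ fullness v ≡ parity l
    fullness-walk alternates {u} nil = p+p≡0ℙ (fullness u)
    fullness-walk alternates {u} {v} (cons {w = w} {l = l} uw p) = begin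
      fullness u ⊕ fullness v
        ≡⟨ ⊕-through (fullness u) (fullness w) (fullness v) ⟩
      (fullness u ⊕ fullness w) ⊕ (fullness w ⊕ fullness v)
        ≡⟨ cong₂ _⊕_ (alternates uw) (fullness-walk alternates p) ⟩
      1ℙ ⊕ parity l
        ≡⟨ sym (parity-suc l) ⟩
      parity (suc l) ∎

  lid⇒even-leaf-distances : IsTree G → (∀ u v → ∃[ z ] z ≢ u × z ≢ v) →
                            LidColourable G 3 → AllLeafDistancesEven G
  lid⇒even-leaf-distances tree third (c , lid) u v d leaf-u leaf-v (walk , _) =
    even⇒double d (begin
      parity d                ≡⟨ sym (fullness-walk alternates walk) ⟩
      fullness u ⊕ fullness v ≡⟨ cong₂ _⊕_ (fullness-leaf leaf-u) (fullness-leaf leaf-v) ⟩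
      0ℙ                      ∎)
    where
    open Fullness c
    alternates : ∀ {x y} → Adj G x y → fullness x ⊕ fullness y ≡ 1ℙ
    alternates {x} {y} xy with third x y
    ... | z , z≢x , z≢y = fullness-edge lid xy (closedNbhds-differ tree z≢x z≢y xy)

  module LevelColouring (tree : IsTree G) (ℓ : Fin n) (leaf-ℓ : IsLeaf G ℓ)
                        (even : AllLeafDistancesEven G) where
    open Rooted (proj₁ tree) ℓ
    open Acyclic (proj₂ tree)

    colour : Fin n → Fin 3
    colour u = levelColour (depth u)

    -- every leaf lies at even depth, its distance to the leaf ℓ being even
    leaf-even : ∀ {u} → IsLeaf G u → parity (depth u) ≡ 0ℙ
    leaf-even {u} leaf-u with even u ℓ (depth u) leaf-u leaf-ℓ (depth-distance u)
    ... | m , d≡m+m = trans (cong parity d≡m+m) (double⇒even m)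

    neighbour-parity : ∀ {x y} → Adj G x y → parity (depth y) ≡ parity (depth x) ⁻¹
    neighbour-parity {x} {y} xy with depth-step xy
    ... | inj₁ dy≡ = trans (cong parity dy≡) (parity-suc (depth x))
    ... | inj₂ dx≡ = sym (trans (cong (λ k → parity k ⁻¹) dx≡) (suc-homo-⁻¹ (depth y)))

    even-nbhd : ∀ {x y} → parity (depth x) ≡ 0ℙ → N[_] G x y → colour y ≡ colour x ⊎ colour y ≡ zero
    even-nbhd ev (inj₁ refl) = inj₁ refl
    even-nbhd {y = y} ev (inj₂ xy) =
      inj₂ (levelColour-odd (depth y) (trans (neighbour-parity xy) (cong _⁻¹ ev)))

    unseen : ∀ {x w} → parity (depth x) ≡ 0ℙ →
             depth w ≡ 2 + depth x ⊎ depth x ≡ 2 + depth w → ¬ colours G colour x (colour w)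
    unseen {x} {w} ev apart (y , y∈ , cy≡cw) with even-nbhd ev y∈
    ... | inj₁ cy≡cx = levelColour-two-apart ev apart (trans (sym cy≡cw) cy≡cx)
    ... | inj₂ cy≡0 = levelColour-even (depth w) (trans (two-apart-parity apart) ev) (trans (sym cy≡cw) cy≡0)
      where
      two-apart-parity : ∀ {j k} → j ≡ 2 + k ⊎ k ≡ 2 + j → parity j ≡ parity k
      two-apart-parity (inj₁ refl) = refl
      two-apart-parity (inj₂ refl) = refl

    -- an odd-depth vertex is no leaf, hence has a neighbour besides its parent u,
    -- which must be a child
    child : ∀ {u v} → Adj G v u → suc (depth u) ≡ depth v → parity (depth v) ≡ 1ℙ →
            Σ (Fin n) λ x → Adj G v x × depth x ≡ suc (depth v)
    child {u} {v} vu du odd with any? (λ x → T? (Graph.adj G v x) ×-dec ¬? (x ≟ u))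
    ... | yes (x , vx , x≢u) = x , vx , [ (λ dx → dx) , not-parent ] (depth-step vx)
      where
      not-parent : depth v ≡ suc (depth x) → depth x ≡ suc (depth v)
      not-parent dv≡ = ⊥-elim (x≢u (parent-unique vx vu (sym dv≡) du))
    ... | no none = ⊥-elim (p≢p⁻¹ 1ℙ (trans (sym odd) (leaf-even (u , vu , only-u))))
      where
      only-u : ∀ x → Adj G v x → x ≡ u
      only-u x vx with x ≟ u
      ... | yes x≡u = x≡u
      ... | no x≢u = ⊥-elim (none (x , vx , x≢u))

    -- For an edge u–v with v one level deeper, the colour of a level two
    -- away from the even end is seen by the odd end only: a grandchild of u
    -- if u is even, the parent of u if u is odd.
    separated : ∀ {u v} → Adj G u v → depth v ≡ suc (depth u) →
                ¬ (∀ a → colours G colour u a ⇔ colours G colour v a)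
    separated {u} {v} uv dv same with parity (depth u) in pu
    ... | 0ℙ with child (adj-sym uv) (sym dv) (trans (neighbour-parity uv) (cong _⁻¹ pu))
    ...   | x , vx , dx = unseen pu (inj₁ (trans dx (cong suc dv)))
                            (Equivalence.from (same (colour x)) (x , inj₂ vx , refl))
    separated {u} {v} uv dv same | 1ℙ with parent-spec u (odd-positive (depth u) pu)
    ... | up , dp = unseen v-even (inj₂ (trans dv (cong suc (sym dp))))
                      (Equivalence.to (same (colour (parent u))) (parent u , inj₂ up , refl))
      where
      v-even : parity (depth v) ≡ 0ℙ
      v-even = trans (neighbour-parity uv) (cong _⁻¹ pu)

    is-lid : IsLidColouring G colour
    is-lid = proper , λ u v uv _ → lid-edge uv
      where
      proper : ProperColouring G colour
      proper u v uv c≡ with depth-step uv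
      ... | inj₁ dv = levelColour-step (depth u) (trans c≡ (cong levelColour dv))
      ... | inj₂ du = levelColour-step (depth v) (trans (sym c≡) (cong levelColour du))
      lid-edge : ∀ {u v} → Adj G u v → ¬ (∀ a → colours G colour u a ⇔ colours G colour v a)
      lid-edge uv same with depth-step uv
      ... | inj₁ dv = separated uv dv same
      ... | inj₂ du = separated (adj-sym uv) du (⇔.sym ∘ same)

  even-leaf-distances⇒lid : IsTree G → ∀ {v₀ v₁ : Fin n} → v₀ ≢ v₁ →
                            AllLeafDistancesEven G → LidColourable G 3
  even-leaf-distances⇒lid tree v₀≢v₁ even with leaf-exists tree v₀≢v₁
  ... | ℓ , leaf-ℓ = colour , is-lid
    where open LevelColouring tree ℓ leaf-ℓ even

third-vertex : ∀ {m} (u v : Fin (3 + m)) → ∃[ z ] z ≢ u × z ≢ v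
third-vertex zero          zero          = suc zero , (λ ()) , (λ ())
third-vertex zero          (suc zero)    = suc (suc zero) , (λ ()) , (λ ())
third-vertex zero          (suc (suc _)) = suc zero , (λ ()) , (λ ())
third-vertex (suc zero)    zero          = suc (suc zero) , (λ ()) , (λ ())
third-vertex (suc zero)    (suc _)       = zero , (λ ()) , (λ ())
third-vertex (suc (suc _)) zero          = suc zero , (λ ()) , (λ ())
third-vertex (suc (suc _)) (suc _)       = zero , (λ ()) , (λ ())

mainTheorem16 : ∀ {n : ℕ} (T : Graph n) → IsTree T → 3 ≤ n →
    LidColourable T 3 ⇔ AllLeafDistancesEven T
mainTheorem16 {suc (suc (suc m))} T tree (s≤s (s≤s (s≤s z≤n))) =
  mk⇔ (lid⇒even-leaf-distances tree third-vertex)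
      (even-leaf-distances⇒lid tree {zero} {suc zero} (λ ()))
  where open GraphFacts T
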